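{- Let $\mathcal{A}\in\mathbb{R}^{n_1\times\cdots\times n_k}$, let $\gamma_j$ be a nonempty subset of $[n_j]$ for $j=1,\ldots,k$, and let $\mathcal{B}=\mathcal{A}[\gamma_1,\ldots,\gamma_k]$. Then ${\rm mr}(\mathcal{A})\ge{\rm mr}(\mathcal{B})$ and ${\rm Mr}(\mathcal{A})\ge{\rm Mr}(\mathcal{B})$.
   Context: $\mathcal{A}[\gamma_1,\ldots,\gamma_k]$ is the subtensor of $\mathcal{A}$ consisting of the entries $a_{i_1\cdots i_k}$ with $i_j\in\gamma_j$ for all $j$. For a real tensor $\mathcal{A}$, $\mathcal{Q}(\mathcal{A})$ is the set of real tensors with the same entrywise sign pattern as $\mathcal{A}$. A rank one tensor is $\alpha_1\otimes\cdots\otimes\alpha_k$ with nonzero vectors $\alpha_j$, entries $(\alpha_1)_{i_1}\cdots(\alpha_k)_{i_k}$; ${\rm rank}(\mathcal{A})$ is the smallest number of rank one tensors summing to $\mathcal{A}$. ${\rm mr}(\mathcal{A})=\min\{{\rm rank}(\mathcal{B}):\mathcal{B}\in\mathcal{Q}(\mathcal{A})\}$, ${\rm Mr}(\mathcal{A})=\max\{{\rm rank}(\mathcal{B}):\mathcal{B}\in\mathcal{Q}(\mathcal{A})\}$. -}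

module Defs where

open import Level using (Level; _⊔_) renaming (suc to lsuc)
open import Data.Nat using (ℕ; _≤_)
import Data.Nat as Nat
open import Data.Fin using (Fin; zero; suc)
open import Data.Fin.Subset using (Subset; _∈_)
open import Data.Product using (Σ; ∃; _×_; _,_; proj₁)
open import Data.Sum using (_⊎_)
open import Relation.Nullary using (¬_)
open import Algebra.Bundles using (CommutativeRing)
open import Relation.Binary.Structures using (IsStrictTotalOrder)

-- The real numbers, axiomatised as a Dedekind-complete ordered field
-- (categorical: every model is isomorphic to ℝ).
record RealField (c ℓ : Level) : Set (lsuc (c ⊔ ℓ)) where
  field
    commRing : CommutativeRing c ℓ
  open CommutativeRing commRing public
  field
    _<_ : Carrier → Carrier → Set ℓ
    <-isStrictTotalOrder : IsStrictTotalOrder _≈_ _<_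
    0<1 : 0# < 1#
    +-monoˡ-< : ∀ x y z → x < y → (x + z) < (y + z)
    *-pos : ∀ x y → 0# < x → 0# < y → 0# < (x * y)
    inverse : ∀ x → ¬ (x ≈ 0#) → ∃ λ y → (x * y) ≈ 1#
  _≤ᴿ_ : Carrier → Carrier → Set ℓ
  x ≤ᴿ y = (x < y) ⊎ (x ≈ y)
  field
    sup : (P : Carrier → Set (c ⊔ ℓ)) → ∃ P → (∃ λ b → ∀ x → P x → x ≤ᴿ b) →
          ∃ λ s → (∀ x → P x → x ≤ᴿ s) × (∀ b → (∀ x → P x → x ≤ᴿ b) → s ≤ᴿ b)

module _ {c ℓ : Level} (R : RealField c ℓ) where
  open RealField R using (Carrier; _≈_; _+_; _*_; 0#; 1#; _<_)

  sumF : ∀ {n} → (Fin n → Carrier) → Carrier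
  sumF {Nat.zero} f = 0#
  sumF {Nat.suc n} f = f zero + sumF (λ i → f (suc i))

  prodF : ∀ {n} → (Fin n → Carrier) → Carrier
  prodF {Nat.zero} f = 1#
  prodF {Nat.suc n} f = f zero * prodF (λ i → f (suc i))

  Tensor : ∀ {k} → (Fin k → Set) → Set c
  Tensor {k} I = ((j : Fin k) → I j) → Carrier

  NonzeroVec : {X : Set} → (X → Carrier) → Set ℓ
  NonzeroVec {X} v = Σ X λ x → ¬ (v x ≈ 0#)

  SumOfRankOne : ∀ {k} {I : Fin k → Set} → Tensor I → ℕ → Set (c ⊔ ℓ)
  SumOfRankOne {k} {I} T r =
    Σ ((s : Fin r) → (j : Fin k) → I j → Carrier) λ α →
      (∀ s j → NonzeroVec (α s j)) ×
      (∀ i → T i ≈ sumF (λ s → prodF (λ j → α s j (i j))))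

  IsRank : ∀ {k} {I : Fin k → Set} → Tensor I → ℕ → Set (c ⊔ ℓ)
  IsRank T r = SumOfRankOne T r × (∀ s → SumOfRankOne T s → r ≤ s)

  _⇔_ : ∀ {a b} → Set a → Set b → Set (a ⊔ b)
  P ⇔ Q = (P → Q) × (Q → P)

  SameSign : Carrier → Carrier → Set ℓ
  SameSign a b = ((0# < a) ⇔ (0# < b)) × ((a ≈ 0#) ⇔ (b ≈ 0#)) × ((a < 0#) ⇔ (b < 0#))

  InQ : ∀ {k} {I : Fin k → Set} → Tensor I → Tensor I → Set ℓ
  InQ A B = ∀ i → SameSign (A i) (B i)

  IsMinRank : ∀ {k} {I : Fin k → Set} → Tensor I → ℕ → Set (c ⊔ ℓ)
  IsMinRank A m = (Σ _ λ B → InQ A B × IsRank B m) ×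
                  (∀ B r → InQ A B → IsRank B r → m ≤ r)

  IsMaxRank : ∀ {k} {I : Fin k → Set} → Tensor I → ℕ → Set (c ⊔ ℓ)
  IsMaxRank A M = (Σ _ λ B → InQ A B × IsRank B M) ×
                  (∀ B r → InQ A B → IsRank B r → r ≤ M)

  subIndex : ∀ {k} (n : Fin k → ℕ) → ((j : Fin k) → Subset (n j)) → Fin k → Set
  subIndex n γ j = Σ (Fin (n j)) λ i → i ∈ γ j

  subtensor : ∀ {k} (n : Fin k → ℕ) → Tensor (λ j → Fin (n j)) →
              (γ : (j : Fin k) → Subset (n j)) → Tensor (subIndex n γ)
  subtensor n A γ i = A (λ j → proj₁ (i j))

-- Restricting a rank one decomposition of a tensor to the box γ₁ × ⋯ × γₖ gives one of the
-- subtensor (terms whose restricted factor vanishes are dropped), so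
-- rank 𝓑[γ] ≤ rank 𝓑; applied to a minimiser 𝓑 ∈ Q(𝓐) this gives mr(𝓐[γ]) ≤ mr(𝓐).
-- Conversely, a maximiser 𝓒 ∈ Q(𝓐[γ]) extends to some 𝓑 ∈ Q(𝓐) with 𝓑[γ] = 𝓒: take any
-- 𝓑₀ ∈ Q(𝓐), subtract its part on the box and add 𝓒 extended by zero, each step
-- keeping a finite sum of rank one terms. Then Mr(𝓐[γ]) = rank 𝓒 ≤ rank 𝓑 ≤ Mr(𝓐).
-- Ranks exist only up to double negation constructively; as the conclusions are
-- decidable inequalities of naturals, that suffices.
module Submission where

open import Defs
open import Level using (Level)
open import Data.Nat using (ℕ; _≤_)
open import Data.Fin using (Fin)
open import Data.Fin.Subset using (Subset; Nonempty)
open import Data.Product using (_×_)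

open import Data.Nat using (zero; suc; _<_; z≤n; s≤s; _≤?_)
import Data.Nat as ℕ
open import Data.Nat.Properties using (≤-trans; m≤n⇒m≤1+n; ≰⇒>)
open import Data.Nat.Induction using (<-rec)
open import Data.Fin using (zero; suc)
open import Data.Fin.Subset using (_∈_; _∉_)
open import Data.Fin.Subset.Properties using (_∈?_)
open import Data.Fin.Properties using (all?; ¬∀⟶∃¬)
open import Data.Vec.Properties.WithK using ([]=-irrelevant)
open import Data.Product using (∃; _,_; proj₁; proj₂)
open import Data.Sum using (_⊎_; inj₁; inj₂)
open import Function using (_∘_)
open import Relation.Nullary using (¬_; Dec; yes; no; contradiction)
open import Relation.Nullary.Negation using (¬¬-map)
open import Relation.Nullary.Decidable using (decidable-stable)
open import Relation.Binary.Structures using (IsStrictTotalOrder)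

module _ {c ℓ : Level} (R : RealField c ℓ) where
  open RealField R hiding (zero; _<_) renaming (refl to ≈-refl)
  open import Algebra.Properties.Ring ring using (-‿distribˡ-*; -0#≈0#; -‿+-comm)
  import Relation.Binary.Reasoning.Setoid as ≈-Reasoning
  open IsStrictTotalOrder <-isStrictTotalOrder using (_≟_; <-respʳ-≈; <-respˡ-≈)

  sumF-cong : ∀ {m} {f g : Fin m → Carrier} → (∀ i → f i ≈ g i) → sumF R f ≈ sumF R g
  sumF-cong {zero} f≈g = ≈-refl
  sumF-cong {suc m} f≈g = +-cong (f≈g zero) (sumF-cong (f≈g ∘ suc))

  prodF-cong : ∀ {m} {f g : Fin m → Carrier} → (∀ i → f i ≈ g i) → prodF R f ≈ prodF R g
  prodF-cong {zero} f≈g = ≈-refl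
  prodF-cong {suc m} f≈g = *-cong (f≈g zero) (prodF-cong (f≈g ∘ suc))

  sumF-≈0 : ∀ {m} (f : Fin m → Carrier) → (∀ i → f i ≈ 0#) → sumF R f ≈ 0#
  sumF-≈0 {zero} f f≈0 = ≈-refl
  sumF-≈0 {suc m} f f≈0 = trans (+-cong (f≈0 zero) (sumF-≈0 (f ∘ suc) (f≈0 ∘ suc))) (+-identityˡ 0#)

  prodF-≈0 : ∀ {m} (f : Fin m → Carrier) j → f j ≈ 0# → prodF R f ≈ 0#
  prodF-≈0 f zero fj≈0 = trans (*-congʳ fj≈0) (zeroˡ _)
  prodF-≈0 f (suc j) fj≈0 = trans (*-congˡ (prodF-≈0 (f ∘ suc) j fj≈0)) (zeroʳ _)

  sumF-neg : ∀ {m} (f : Fin m → Carrier) → sumF R (λ s → - f s) ≈ - sumF R f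
  sumF-neg {zero} f = sym -0#≈0#
  sumF-neg {suc m} f = trans (+-congˡ (sumF-neg (f ∘ suc))) (-‿+-comm _ _)

  SameSign-respʳ : ∀ {a b b′} → SameSign R a b → b ≈ b′ → SameSign R a b′
  SameSign-respʳ ((pos⇒ , ⇐pos) , (zero⇒ , ⇐zero) , (neg⇒ , ⇐neg)) b≈b′ =
    ((<-respʳ-≈ b≈b′ ∘ pos⇒) , (⇐pos ∘ <-respʳ-≈ (sym b≈b′))) ,
    ((trans (sym b≈b′) ∘ zero⇒) , (⇐zero ∘ trans b≈b′)) ,
    ((<-respˡ-≈ b≈b′ ∘ neg⇒) , (⇐neg ∘ <-respˡ-≈ (sym b≈b′)))

  Terms : ∀ {k} → (Fin k → Set) → ℕ → Set c
  Terms {k} I r = Fin r → (j : Fin k) → I j → Carrier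

  ZeroTestable : Set → Set (c Level.⊔ ℓ)
  ZeroTestable X = (v : X → Carrier) → NonzeroVec R v ⊎ (∀ x → v x ≈ 0#)

  factorsNonzero? : ∀ {k} {I : Fin k → Set} → (∀ j → ZeroTestable (I j)) →
                    (α : (j : Fin k) → I j → Carrier) →
                    (∀ j → NonzeroVec R (α j)) ⊎ ∃ λ j → ∀ x → α j x ≈ 0#
  factorsNonzero? {zero} test α = inj₁ λ ()
  factorsNonzero? {suc k} test α with test zero (α zero) | factorsNonzero? (test ∘ suc) (α ∘ suc)
  ... | inj₂ α₀≈0 | _ = inj₂ (zero , α₀≈0)
  ... | inj₁ α₀≠0 | inj₁ rest≠0 = inj₁ λ { zero → α₀≠0 ; (suc j) → rest≠0 j }
  ... | inj₁ _ | inj₂ (j , αj≈0) = inj₂ (suc j , αj≈0)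

  module _ {k : ℕ} {I : Fin k → Set} where

    SumOfRankOne-resp : ∀ {T T′ : Tensor R I} {r} → (∀ i → T i ≈ T′ i) →
                        SumOfRankOne R T r → SumOfRankOne R T′ r
    SumOfRankOne-resp T≈T′ (α , nonzero , T≈) = α , nonzero , λ i → trans (sym (T≈T′ i)) (T≈ i)

    IsRank-resp : ∀ {T T′ : Tensor R I} {r} → (∀ i → T i ≈ T′ i) → IsRank R T r → IsRank R T′ r
    IsRank-resp T≈T′ (decomposition , minimal) =
      SumOfRankOne-resp T≈T′ decomposition ,
      λ s → minimal s ∘ SumOfRankOne-resp (sym ∘ T≈T′)

    rank-¬¬exists : ∀ {T : Tensor R I} {s} → SumOfRankOne R T s → ¬ ¬ ∃ (IsRank R T)
    rank-¬¬exists {T} {s} = <-rec (λ s → SumOfRankOne R T s → ¬ ¬ ∃ (IsRank R T)) step s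
      where
        step : ∀ s → (∀ {t} → t < s → SumOfRankOne R T t → ¬ ¬ ∃ (IsRank R T)) →
               SumOfRankOne R T s → ¬ ¬ ∃ (IsRank R T)
        step s shorter decomposition noRank = noRank (s , decomposition , minimal)
          where
            minimal : ∀ t → SumOfRankOne R T t → s ≤ t
            minimal t other with s ≤? t
            ... | yes s≤t = s≤t
            ... | no s≰t = contradiction noRank (shorter (≰⇒> s≰t) other)

    ⟦_⟧ : ∀ {r} → Terms I r → Tensor R I
    ⟦ β ⟧ i = sumF R (λ s → prodF R (λ j → β s j (i j)))

    _++ᵗ_ : ∀ {r r′} → Terms I r → Terms I r′ → Terms I (r ℕ.+ r′)
    _++ᵗ_ {zero} β β′ = β′
    _++ᵗ_ {suc r} β β′ zero = β zero
    _++ᵗ_ {suc r} β β′ (suc s) = ((β ∘ suc) ++ᵗ β′) s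

    ⟦++ᵗ⟧ : ∀ {r r′} (β : Terms I r) (β′ : Terms I r′) i → ⟦ β ++ᵗ β′ ⟧ i ≈ ⟦ β ⟧ i + ⟦ β′ ⟧ i
    ⟦++ᵗ⟧ {zero} β β′ i = sym (+-identityˡ _)
    ⟦++ᵗ⟧ {suc r} β β′ i = trans (+-congˡ (⟦++ᵗ⟧ (β ∘ suc) β′ i)) (sym (+-assoc _ _ _))

    prune : (∀ j → ZeroTestable (I j)) → ∀ {r} (β : Terms I r) →
            ∃ λ r′ → r′ ≤ r × SumOfRankOne R ⟦ β ⟧ r′
    prune test {zero} β = 0 , z≤n , (λ ()) , (λ ()) , λ i → ≈-refl
    prune test {suc r} β with prune test (β ∘ suc) | factorsNonzero? test (β zero)
    ... | r′ , r′≤r , α , α≠0 , ⟦β⟧≈ | inj₁ β₀≠0 =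
      suc r′ , s≤s r′≤r , (λ { zero → β zero ; (suc s) → α s }) ,
      (λ { zero → β₀≠0 ; (suc s) → α≠0 s }) , λ i → +-congˡ (⟦β⟧≈ i)
    ... | r′ , r′≤r , α , α≠0 , ⟦β⟧≈ | inj₂ (j , β₀j≈0) =
      r′ , m≤n⇒m≤1+n r′≤r , α , α≠0 ,
      λ i → trans (+-cong (prodF-≈0 _ j (β₀j≈0 (i j))) (⟦β⟧≈ i)) (+-identityˡ _)

  negateᵗ : ∀ {k} {I : Fin (suc k) → Set} {r} → Terms I r → Terms I r
  negateᵗ β s zero x = - β s zero x
  negateᵗ β s (suc j) x = β s (suc j) x

  ⟦negateᵗ⟧ : ∀ {k} {I : Fin (suc k) → Set} {r} (β : Terms I r) i → ⟦ negateᵗ β ⟧ i ≈ - ⟦ β ⟧ i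
  ⟦negateᵗ⟧ β i =
    trans (sumF-cong λ s → sym (-‿distribˡ-* (β s zero (i zero)) (prodF R λ j → β s (suc j) (i (suc j)))))
          (sumF-neg λ s → prodF R λ j → β s j (i j))

  Fin-zeroTestable : ∀ {n} → ZeroTestable (Fin n)
  Fin-zeroTestable v with all? (λ x → v x ≟ 0#)
  ... | yes v≈0 = inj₂ v≈0
  ... | no v≉0 = inj₁ (¬∀⟶∃¬ _ _ (λ x → v x ≟ 0#) v≉0)

  module _ {k : ℕ} {n : Fin k → ℕ} (γ : (j : Fin k) → Subset (n j)) where

    InBox : ((j : Fin k) → Fin (n j)) → Set
    InBox i = ∀ j → i j ∈ γ j

    outside-box : ∀ {i} → ¬ InBox i → ∃ λ j → i j ∉ γ j
    outside-box {i} = ¬∀⟶∃¬ k (λ j → i j ∈ γ j) (λ j → i j ∈? γ j)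

    extend : ∀ j → (subIndex R n γ j → Carrier) → Fin (n j) → Carrier
    extend j v x with x ∈? γ j
    ... | yes x∈γ = v (x , x∈γ)
    ... | no _ = 0#

    extend-∈ : ∀ j v x (x∈γ : x ∈ γ j) → extend j v x ≈ v (x , x∈γ)
    extend-∈ j v x x∈γ with x ∈? γ j
    ... | yes x∈γ′ rewrite []=-irrelevant x∈γ′ x∈γ = ≈-refl
    ... | no x∉γ = contradiction x∈γ x∉γ

    extend-∉ : ∀ j v x → x ∉ γ j → extend j v x ≈ 0#
    extend-∉ j v x x∉γ with x ∈? γ j
    ... | yes x∈γ = contradiction x∈γ x∉γ
    ... | no _ = ≈-refl

    subIndex-zeroTestable : ∀ j → ZeroTestable (subIndex R n γ j)
    subIndex-zeroTestable j v with Fin-zeroTestable (extend j v)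
    ... | inj₂ extended≈0 = inj₂ λ (x , x∈γ) → trans (sym (extend-∈ j v x x∈γ)) (extended≈0 x)
    ... | inj₁ (x , extended≉0) = inj₁ (witness (x ∈? γ j))
      where
        witness : Dec (x ∈ γ j) → NonzeroVec R v
        witness (yes x∈γ) = (x , x∈γ) , extended≉0 ∘ trans (extend-∈ j v x x∈γ)
        witness (no x∉γ) = contradiction (extend-∉ j v x x∉γ) extended≉0

    restrictᵗ : ∀ {r} → Terms (Fin ∘ n) r → Terms (subIndex R n γ) r
    restrictᵗ β s j x = β s j (proj₁ x)

    extendᵗ : ∀ {r} → Terms (subIndex R n γ) r → Terms (Fin ∘ n) r
    extendᵗ β s j = extend j (β s j)

    maskᵗ : ∀ {r} → Terms (Fin ∘ n) r → Terms (Fin ∘ n) r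
    maskᵗ = extendᵗ ∘ restrictᵗ

    ⟦extendᵗ⟧-∈ : ∀ {r} (β : Terms (subIndex R n γ) r) i (i∈ : InBox i) →
                  ⟦ extendᵗ β ⟧ i ≈ ⟦ β ⟧ (λ j → i j , i∈ j)
    ⟦extendᵗ⟧-∈ β i i∈ = sumF-cong λ s → prodF-cong λ j → extend-∈ j (β s j) (i j) (i∈ j)

    ⟦extendᵗ⟧-∉ : ∀ {r} (β : Terms (subIndex R n γ) r) i → ¬ InBox i → ⟦ extendᵗ β ⟧ i ≈ 0#
    ⟦extendᵗ⟧-∉ β i i∉ with outside-box i∉
    ... | j , ij∉γ = sumF-≈0 _ λ s → prodF-≈0 _ j (extend-∉ j (β s j) (i j) ij∉γ)

    subtensor-sumOfRankOne : ∀ {T : Tensor R (Fin ∘ n)} {r} → SumOfRankOne R T r →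
                             ∃ λ r′ → r′ ≤ r × SumOfRankOne R (subtensor R n T γ) r′
    subtensor-sumOfRankOne (α , _ , T≈) with prune subIndex-zeroTestable (restrictᵗ α)
    ... | r′ , r′≤r , decomposition =
      r′ , r′≤r , SumOfRankOne-resp (λ i → sym (T≈ (λ j → proj₁ (i j)))) decomposition

    subtensor-rank≤ : ∀ {T : Tensor R (Fin ∘ n)} {r s} → IsRank R (subtensor R n T γ) r →
                      SumOfRankOne R T s → r ≤ s
    subtensor-rank≤ (_ , minimal) decomposition with subtensor-sumOfRankOne decomposition
    ... | s′ , s′≤s , restricted = ≤-trans (minimal s′ restricted) s′≤s

  erasedLength : ℕ → ℕ → ℕ
  erasedLength zero r = 0
  erasedLength (suc k) r = r ℕ.+ r

  -- For k = 0 every index lies in the box, and negation needs a factor to act on.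
  eraseBox : ∀ {k} {n : Fin k → ℕ} (γ : (j : Fin k) → Subset (n j)) {r} →
             Terms (Fin ∘ n) r → Terms (Fin ∘ n) (erasedLength k r)
  eraseBox {zero} γ β = λ ()
  eraseBox {suc k} γ β = β ++ᵗ negateᵗ (maskᵗ γ β)

  ⟦eraseBox⟧-∈ : ∀ {k} {n : Fin k → ℕ} (γ : (j : Fin k) → Subset (n j)) {r}
                 (β : Terms (Fin ∘ n) r) i → InBox γ i → ⟦ eraseBox γ β ⟧ i ≈ 0#
  ⟦eraseBox⟧-∈ {zero} γ β i i∈ = ≈-refl
  ⟦eraseBox⟧-∈ {suc k} γ β i i∈ = begin
    ⟦ β ++ᵗ negateᵗ (maskᵗ γ β) ⟧ i          ≈⟨ ⟦++ᵗ⟧ β (negateᵗ (maskᵗ γ β)) i ⟩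
    ⟦ β ⟧ i + ⟦ negateᵗ (maskᵗ γ β) ⟧ i      ≈⟨ +-congˡ (⟦negateᵗ⟧ (maskᵗ γ β) i) ⟩
    ⟦ β ⟧ i - ⟦ maskᵗ γ β ⟧ i                ≈⟨ +-congˡ (-‿cong (⟦extendᵗ⟧-∈ γ (restrictᵗ γ β) i i∈)) ⟩
    ⟦ β ⟧ i - ⟦ β ⟧ i                        ≈⟨ -‿inverseʳ _ ⟩
    0#                                       ∎
    where open ≈-Reasoning setoid

  ⟦eraseBox⟧-∉ : ∀ {k} {n : Fin k → ℕ} (γ : (j : Fin k) → Subset (n j)) {r}
                 (β : Terms (Fin ∘ n) r) i → ¬ InBox γ i → ⟦ eraseBox γ β ⟧ i ≈ ⟦ β ⟧ i
  ⟦eraseBox⟧-∉ {zero} γ β i i∉ = contradiction (λ ()) i∉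
  ⟦eraseBox⟧-∉ {suc k} γ β i i∉ = begin
    ⟦ β ++ᵗ negateᵗ (maskᵗ γ β) ⟧ i          ≈⟨ ⟦++ᵗ⟧ β (negateᵗ (maskᵗ γ β)) i ⟩
    ⟦ β ⟧ i + ⟦ negateᵗ (maskᵗ γ β) ⟧ i      ≈⟨ +-congˡ (⟦negateᵗ⟧ (maskᵗ γ β) i) ⟩
    ⟦ β ⟧ i - ⟦ maskᵗ γ β ⟧ i                ≈⟨ +-congˡ (-‿cong (⟦extendᵗ⟧-∉ γ (restrictᵗ γ β) i i∉)) ⟩
    ⟦ β ⟧ i - 0#                             ≈⟨ +-congˡ -0#≈0# ⟩
    ⟦ β ⟧ i + 0#                             ≈⟨ +-identityʳ _ ⟩
    ⟦ β ⟧ i                                  ∎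
    where open ≈-Reasoning setoid

  boxReplaced : ∀ {k} {n : Fin k → ℕ} (γ : (j : Fin k) → Subset (n j)) {r r′} →
                Terms (Fin ∘ n) r → Terms (subIndex R n γ) r′ → Terms (Fin ∘ n) (erasedLength k r ℕ.+ r′)
  boxReplaced γ β β′ = eraseBox γ β ++ᵗ extendᵗ γ β′

  module _ {k : ℕ} {n : Fin k → ℕ} (γ : (j : Fin k) → Subset (n j)) {r r′ : ℕ}
           (β : Terms (Fin ∘ n) r) (β′ : Terms (subIndex R n γ) r′) where

    ⟦boxReplaced⟧-∈ : ∀ i (i∈ : InBox γ i) → ⟦ boxReplaced γ β β′ ⟧ i ≈ ⟦ β′ ⟧ (λ j → i j , i∈ j)
    ⟦boxReplaced⟧-∈ i i∈ =
      trans (⟦++ᵗ⟧ (eraseBox γ β) (extendᵗ γ β′) i)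
        (trans (+-cong (⟦eraseBox⟧-∈ γ β i i∈) (⟦extendᵗ⟧-∈ γ β′ i i∈)) (+-identityˡ _))

    ⟦boxReplaced⟧-∉ : ∀ i → ¬ InBox γ i → ⟦ boxReplaced γ β β′ ⟧ i ≈ ⟦ β ⟧ i
    ⟦boxReplaced⟧-∉ i i∉ =
      trans (⟦++ᵗ⟧ (eraseBox γ β) (extendᵗ γ β′) i)
        (trans (+-cong (⟦eraseBox⟧-∉ γ β i i∉) (⟦extendᵗ⟧-∉ γ β′ i i∉)) (+-identityʳ _))

  module _ {k : ℕ} (n : Fin k → ℕ) (A : Tensor R (Fin ∘ n)) (γ : (j : Fin k) → Subset (n j)) where

    mr-subtensor≤ : ∀ {m m′} → IsMinRank R A m → IsMinRank R (subtensor R n A γ) m′ → m′ ≤ m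
    mr-subtensor≤ {m} {m′} ((B , B∈Q , B-rank) , _) (_ , minimal)
      with subtensor-sumOfRankOne γ (proj₁ B-rank)
    ... | _ , _ , restricted = decidable-stable (m′ ≤? m) (¬¬-map bound (rank-¬¬exists restricted))
      where
        bound : ∃ (IsRank R (subtensor R n B γ)) → m′ ≤ m
        bound (r , rank) =
          ≤-trans (minimal _ r (λ i → B∈Q (λ j → proj₁ (i j))) rank) (subtensor-rank≤ γ rank (proj₁ B-rank))

    Mr-subtensor≤ : ∀ {M M′} → IsMaxRank R A M → IsMaxRank R (subtensor R n A γ) M′ → M′ ≤ M
    Mr-subtensor≤ {M} {M′} ((_ , B₀∈Q , (α₀ , _ , B₀≈) , _) , maximal)
                           ((_ , C∈Q , C-rank@((αC , _ , C≈) , _)) , _)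
      with prune (λ _ → Fin-zeroTestable) (boxReplaced γ α₀ αC)
    ... | _ , _ , decomposition = decidable-stable (M′ ≤? M) (¬¬-map bound (rank-¬¬exists decomposition))
      where
        B : Tensor R (Fin ∘ n)
        B = ⟦ boxReplaced γ α₀ αC ⟧

        B∈Q : InQ R A B
        B∈Q i with all? (λ j → i j ∈? γ j)
        ... | yes i∈ = SameSign-respʳ (C∈Q _) (trans (C≈ _) (sym (⟦boxReplaced⟧-∈ γ α₀ αC i i∈)))
        ... | no i∉ = SameSign-respʳ (B₀∈Q i) (trans (B₀≈ i) (sym (⟦boxReplaced⟧-∉ γ α₀ αC i i∉)))

        subtensor-rank : IsRank R (subtensor R n B γ) M′
        subtensor-rank =
          IsRank-resp (λ i → trans (C≈ i) (sym (⟦boxReplaced⟧-∈ γ α₀ αC _ (λ j → proj₂ (i j))))) C-rank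

        bound : ∃ (IsRank R B) → M′ ≤ M
        bound (r , B-rank) =
          ≤-trans (subtensor-rank≤ γ subtensor-rank (proj₁ B-rank)) (maximal B r B∈Q B-rank)

theorem3p4 : ∀ {c ℓ : Level} (R : RealField c ℓ) (k : ℕ) (n : Fin k → ℕ)
    (A : Tensor R (λ j → Fin (n j))) (γ : (j : Fin k) → Subset (n j)) →
    (∀ j → Nonempty (γ j)) →
    (∀ m m' → IsMinRank R A m → IsMinRank R (subtensor R n A γ) m' → m' ≤ m) ×
    (∀ M M' → IsMaxRank R A M → IsMaxRank R (subtensor R n A γ) M' → M' ≤ M)
theorem3p4 R k n A γ _ = (λ _ _ → mr-subtensor≤ R n A γ) , (λ _ _ → Mr-subtensor≤ R n A γ)
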